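{- Let $n\ge 1$. The map $\pi\mapsto(\alpha(\pi),\beta(\pi),\gamma(\pi))$ is a bijection between $\Pi_B(n)$ and the set of triples $(\sigma,X,Y)$, where $\sigma\in\Pi(n)$, $X$ is a set of blocks of $\sigma$, and $Y$ is a maximal matching on $X$.
   Context: $[n]=\{1,\dots,n\}$, $[\pm n]=\{1,\dots,n,-1,\dots,-n\}$, and $\Pi(n)$ is the set of set partitions of $[n]$. A partition of type $B_n$ is a set partition $\pi$ of $[\pm n]$ such that whenever $B$ is a block, $-B=\{ -x:x\in B\}$ is also a block, and at most one block (called the zero block) satisfies $B=-B$. $\Pi_B(n)$ denotes the set of partitions of type $B_n$. For a block $B$ of $\pi\in\Pi_B(n)$, $B^+$ is the set of positive integers in $B$. Define: $\alpha(\pi)\in\Pi(n)$ is the partition whose blocks are exactly the nonempty sets $B^+$ for $B\in\pi$; $\beta(\pi)$ is the set of blocks $A\in\alpha(\pi)$ such that the block of $\pi$ containing $A$ also contains at least one negative integer; $\gamma(\pi)$ is the matching on $\beta(\pi)$ in which $\{A_1,A_2\}$ is a matched pair iff $A_1\neq A_2$ and $A_1\cup(-A_2)$ is a block of $\pi$. A matching on a set $X$ is a set of pairwise disjoint 2-element subsets of $X$; it is maximal if at most one element of $X$ is unmatched. -}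

module Defs where

open import Data.Nat using (ℕ; zero; suc)
open import Data.Fin using (Fin; zero; suc)
open import Data.Bool using (Bool; true; false; _∧_; _∨_; not; T)
open import Data.Product using (Σ; _×_; _,_)
open import Relation.Binary.PropositionalEquality using (_≡_)
open import Relation.Nullary using (¬_)

-- Signed elements: [±n] = {1..n} ∪ {-1..-n}; pos i = +i, neg i = -i.
data Signed (n : ℕ) : Set where
  pos : Fin n → Signed n
  neg : Fin n → Signed n

negate : ∀ {n} → Signed n → Signed n
negate (pos i) = neg i
negate (neg i) = pos i

anyFin : ∀ {n} → (Fin n → Bool) → Bool
anyFin {zero}  f = false
anyFin {suc n} f = f zero ∨ anyFin (λ i → f (suc i))

-- A set partition of a finite set A is represented by its (decidable)
-- equivalence relation "x and y lie in the same block".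
record IsEquivalenceB {A : Set} (R : A → A → Bool) : Set where
  field
    reflB  : ∀ x → T (R x x)
    symB   : ∀ x y → T (R x y) → T (R y x)
    transB : ∀ x y z → T (R x y) → T (R y z) → T (R x z)

IsSetPartition : (n : ℕ) → (Fin n → Fin n → Bool) → Set
IsSetPartition n R = IsEquivalenceB R

record IsTypeB (n : ℕ) (P : Signed n → Signed n → Bool) : Set where
  field
    equiv    : IsEquivalenceB P
    -- B a block ⇒ -B a block
    negClosed : ∀ x y → P x y ≡ P (negate x) (negate y)
    -- at most one block B with B = -B (the zero block)
    atMostOneZero : ∀ x y → T (P x (negate x)) → T (P y (negate y)) → T (P x y)

-- A triple (σ, X, Y): σ ∈ Π(n) given by R; X a set of blocks of σ given as
-- an R-invariant predicate on [n]; Y a matching on X given as an R-invariant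
-- relation M on [n] (M i j: the block of i is matched with the block of j).
record IsTriple (n : ℕ) (R : Fin n → Fin n → Bool) (X : Fin n → Bool)
                (M : Fin n → Fin n → Bool) : Set where
  field
    partition : IsSetPartition n R
    X-blocks  : ∀ i j → T (R i j) → X i ≡ X j
    M-blocksˡ : ∀ i i' j → T (R i i') → M i j ≡ M i' j
    M-blocksʳ : ∀ i j j' → T (R j j') → M i j ≡ M i j'
    M-inX     : ∀ i j → T (M i j) → T (X i) × T (X j)
    M-sym     : ∀ i j → T (M i j) → T (M j i)
    M-distinct : ∀ i j → T (M i j) → ¬ T (R i j)
    M-disjoint : ∀ i j k → T (M i j) → T (M i k) → T (R j k)
    -- maximal: at most one block of X is unmatched
    M-maximal : ∀ i j → T (X i) → T (X j)
                → (∀ k → ¬ T (M i k)) → (∀ k → ¬ T (M j k)) → T (R i j)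

-- α(π): blocks are the nonempty B⁺.
α : ∀ {n} → (Signed n → Signed n → Bool) → Fin n → Fin n → Bool
α P i j = P (pos i) (pos j)

-- β(π): blocks A of α(π) whose π-block contains a negative integer.
β : ∀ {n} → (Signed n → Signed n → Bool) → Fin n → Bool
β P i = anyFin (λ j → P (pos i) (neg j))

-- γ(π): A₁ ≠ A₂ and A₁ ∪ (-A₂) is a block of π, where A₁ ∋ i, A₂ ∋ j.
γ : ∀ {n} → (Signed n → Signed n → Bool) → Fin n → Fin n → Bool
γ P i j = P (pos i) (neg j) ∧ not (P (pos i) (pos j))

_≐₁_ : ∀ {A : Set} → (A → Bool) → (A → Bool) → Set
f ≐₁ g = ∀ x → f x ≡ g x

_≐₂_ : ∀ {A : Set} → (A → A → Bool) → (A → A → Bool) → Set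
f ≐₂ g = ∀ x y → f x y ≡ g x y

module Submission where

-- A type-B partition P of [±n] is determined by its restriction to positive
-- pairs, which is α P, and by its "crossing" part i ~ -j, since the other two
-- quadrants follow by negation.  The crossing part is recovered from the
-- triple by one formula: i ~ -j iff the blocks of i and j are matched by γ,
-- or i and j lie in the same block and that block is the positive half of
-- the zero block, i.e. it lies in β but is unmatched.
--
-- Then, for a type-B partition, the triple is
-- valid and P is the signed lift of its crossing formula (which gives
-- injectivity); for a valid triple, the signed lift of its crossing formula is
-- a type-B partition mapping back to it (surjectivity).  The argument does
-- not use the hypothesis n ≥ 1.

open import Defs
open import Data.Nat using (ℕ; _≤_)
import Data.Nat as ℕ
open import Data.Fin using (Fin; zero; suc)
open import Data.Bool using (Bool; true; false; _∧_; _∨_; not; T)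
open import Data.Bool.Properties using (T-∧; T-∨; T-≡; ⇔→≡)
open import Data.Product using (Σ; ∃; _×_; _,_; proj₁; proj₂)
open import Data.Sum using (_⊎_; inj₁; inj₂)
open import Data.Empty using (⊥-elim)
open import Function using (_∘_)
open import Function.Bundles using (Equivalence; mk⇔)
open import Relation.Nullary using (¬_; yes; no; T?)
open import Relation.Binary.PropositionalEquality
  using (_≡_; refl; sym; trans; cong; cong₂; subst; module ≡-Reasoning)

open Equivalence using (to; from)

∧⁺ : ∀ {a b} → T a → T b → T (a ∧ b)
∧⁺ {a} {b} p q = from (T-∧ {a} {b}) (p , q)

∧⁻ : ∀ {a b} → T (a ∧ b) → T a × T b
∧⁻ {a} {b} = to (T-∧ {a} {b})

∨⁺ : ∀ {a b} → T a ⊎ T b → T (a ∨ b)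
∨⁺ {a} {b} = from (T-∨ {a} {b})

∨⁻ : ∀ {a b} → T (a ∨ b) → T a ⊎ T b
∨⁻ {a} {b} = to (T-∨ {a} {b})

not⁺ : ∀ {a} → ¬ T a → T (not a)
not⁺ {true}  ¬a = ¬a _
not⁺ {false} _  = _

not⁻ : ∀ {a} → T (not a) → ¬ T a
not⁻ {true} ()

T-ext : ∀ {a b} → (T a → T b) → (T b → T a) → a ≡ b
T-ext f g = ⇔→≡ (mk⇔ (to T-≡ ∘ f ∘ from T-≡) (to T-≡ ∘ g ∘ from T-≡))

anyFin⁺ : ∀ {n} (f : Fin n → Bool) k → T (f k) → T (anyFin f)
anyFin⁺ f zero    p = ∨⁺ {f zero} (inj₁ p)
anyFin⁺ f (suc k) p = ∨⁺ {f zero} (inj₂ (anyFin⁺ (f ∘ suc) k p))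

anyFin⁻ : ∀ {n} (f : Fin n → Bool) → T (anyFin f) → ∃ λ k → T (f k)
anyFin⁻ {ℕ.suc n} f p with ∨⁻ {f zero} p
... | inj₁ q = zero , q
... | inj₂ q with anyFin⁻ (f ∘ suc) q
...   | k , r = suc k , r

anyFin-none : ∀ {n} (f : Fin n → Bool) → T (not (anyFin f)) → ∀ k → ¬ T (f k)
anyFin-none f none k p = not⁻ none (anyFin⁺ f k p)

anyFin-cong : ∀ {n} {f g : Fin n → Bool} → f ≐₁ g → anyFin f ≡ anyFin g
anyFin-cong {ℕ.zero}  e = refl
anyFin-cong {ℕ.suc n} e = cong₂ _∨_ (e zero) (anyFin-cong (e ∘ suc))

-- The reconstruction formula.  For a candidate triple (σ, X, M), 'zeroBlock'
-- marks the blocks of X left unmatched (the positive half of the zero block)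
-- and 'crossing' predicts whether i ~ -j.

zeroBlock : ∀ {n} → (Fin n → Bool) → (Fin n → Fin n → Bool) → Fin n → Bool
zeroBlock X M i = X i ∧ not (anyFin (M i))

crossing : ∀ {n} → (Fin n → Fin n → Bool) → (Fin n → Bool) → (Fin n → Fin n → Bool)
         → Fin n → Fin n → Bool
crossing R X M i j = M i j ∨ (R i j ∧ zeroBlock X M i)

crossing-cong : ∀ {n} {R R' M M' : Fin n → Fin n → Bool} {X X' : Fin n → Bool}
              → R ≐₂ R' → X ≐₁ X' → M ≐₂ M' → crossing R X M ≐₂ crossing R' X' M'
crossing-cong eR eX eM i j =
  cong₂ _∨_ (eM i j) (cong₂ _∧_ (eR i j) (cong₂ _∧_ (eX i) (cong not (anyFin-cong (eM i)))))

signedLift : ∀ {n} → (Fin n → Fin n → Bool) → (Fin n → Fin n → Bool)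
           → Signed n → Signed n → Bool
signedLift R A (pos i) (pos j) = R i j
signedLift R A (neg i) (neg j) = R i j
signedLift R A (pos i) (neg j) = A i j
signedLift R A (neg i) (pos j) = A i j

signedLift-cong : ∀ {n} {R R' A A' : Fin n → Fin n → Bool}
                → R ≐₂ R' → A ≐₂ A' → signedLift R A ≐₂ signedLift R' A'
signedLift-cong eR eA (pos i) (pos j) = eR i j
signedLift-cong eR eA (neg i) (neg j) = eR i j
signedLift-cong eR eA (pos i) (neg j) = eA i j
signedLift-cong eR eA (neg i) (pos j) = eA i j

record IsCrossing {n} (R A : Fin n → Fin n → Bool) : Set where
  field
    A-sym   : ∀ i j → T (A i j) → T (A j i)
    A-respˡ : ∀ i i' j → T (R i i') → T (A i j) → T (A i' j)
    A-A⇒R   : ∀ i j k → T (A i j) → T (A j k) → T (R i k)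
    A-diag  : ∀ i j → T (A i i) → T (A j j) → T (R i j)

module _ {n} {R A : Fin n → Fin n → Bool}
         (eq : IsEquivalenceB R) (cr : IsCrossing R A) where
  open IsEquivalenceB eq
  open IsCrossing cr

  private
    A-respʳ : ∀ i j j' → T (R j j') → T (A i j) → T (A i j')
    A-respʳ i j j' r a = A-sym j' i (A-respˡ j j' i r (A-sym i j a))

    A-respˡ⁻ : ∀ i i' j → T (R i' i) → T (A i j) → T (A i' j)
    A-respˡ⁻ i i' j r = A-respˡ i i' j (symB i' i r)

    L = signedLift R A

    lift-refl : ∀ x → T (L x x)
    lift-refl (pos i) = reflB i
    lift-refl (neg i) = reflB i

    lift-sym : ∀ x y → T (L x y) → T (L y x)
    lift-sym (pos i) (pos j) = symB i j
    lift-sym (neg i) (neg j) = symB i j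
    lift-sym (pos i) (neg j) = A-sym i j
    lift-sym (neg i) (pos j) = A-sym i j

    lift-trans : ∀ x y z → T (L x y) → T (L y z) → T (L x z)
    lift-trans (pos i) (pos j) (pos k) p q = transB i j k p q
    lift-trans (neg i) (neg j) (neg k) p q = transB i j k p q
    lift-trans (pos i) (pos j) (neg k) p q = A-respˡ⁻ j i k p q
    lift-trans (neg i) (neg j) (pos k) p q = A-respˡ⁻ j i k p q
    lift-trans (pos i) (neg j) (neg k) p q = A-respʳ i j k q p
    lift-trans (neg i) (pos j) (pos k) p q = A-respʳ i j k q p
    lift-trans (pos i) (neg j) (pos k) p q = A-A⇒R i j k p q
    lift-trans (neg i) (pos j) (neg k) p q = A-A⇒R i j k p q

    lift-neg : ∀ x y → L x y ≡ L (negate x) (negate y)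
    lift-neg (pos i) (pos j) = refl
    lift-neg (neg i) (neg j) = refl
    lift-neg (pos i) (neg j) = refl
    lift-neg (neg i) (pos j) = refl

    lift-oneZero : ∀ x y → T (L x (negate x)) → T (L y (negate y)) → T (L x y)
    lift-oneZero (pos i) (pos j) a b = A-diag i j a b
    lift-oneZero (neg i) (neg j) a b = A-diag i j a b
    lift-oneZero (pos i) (neg j) a b = A-respʳ i i j (A-diag i j a b) a
    lift-oneZero (neg i) (pos j) a b = A-respʳ i i j (A-diag i j a b) a

  signedLift-typeB : IsTypeB n (signedLift R A)
  signedLift-typeB = record
    { equiv         = record { reflB = lift-refl ; symB = lift-sym ; transB = lift-trans }
    ; negClosed     = lift-neg
    ; atMostOneZero = lift-oneZero
    }

module FromTypeB {n} (P : Signed n → Signed n → Bool) (tb : IsTypeB n P) where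
  open IsTypeB tb
  open IsEquivalenceB equiv

  negate-rel : ∀ x y → T (P x y) → T (P (negate x) (negate y))
  negate-rel x y = subst T (negClosed x y)

  cross-sym : ∀ i j → T (P (pos i) (neg j)) → T (P (pos j) (neg i))
  cross-sym i j p = symB (neg i) (pos j) (negate-rel (pos i) (neg j) p)

  selfNeg-of-both : ∀ i j → T (P (pos i) (neg j)) → T (P (pos i) (pos j))
                  → T (P (pos i) (neg i))
  selfNeg-of-both i j p q =
    transB (pos i) (neg j) (neg i) p (symB (neg i) (neg j) (negate-rel (pos i) (pos j) q))

  selfNeg-neg⇒pos : ∀ i k → T (P (pos i) (neg i)) → T (P (pos i) (neg k))
                  → T (P (pos i) (pos k))
  selfNeg-neg⇒pos i k z p =
    negate-rel (neg i) (neg k) (transB (neg i) (pos i) (neg k) (symB (pos i) (neg i) z) p)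

  selfNeg-pos⇒neg : ∀ i j → T (P (pos i) (neg i)) → T (P (pos i) (pos j))
                  → T (P (pos i) (neg j))
  selfNeg-pos⇒neg i j z q = transB (pos i) (neg i) (neg j) z (negate-rel (pos i) (pos j) q)

  selfNeg-of-unmatched : ∀ i → T (β P i) → (∀ k → ¬ T (γ P i k)) → T (P (pos i) (neg i))
  selfNeg-of-unmatched i b unmatched with anyFin⁻ _ b
  ... | k , p with T? (P (pos i) (pos k))
  ...   | yes q = selfNeg-of-both i k p q
  ...   | no ¬q = ⊥-elim (unmatched k (∧⁺ p (not⁺ ¬q)))

  unmatched-of-selfNeg : ∀ i → T (P (pos i) (neg i)) → ∀ k → ¬ T (γ P i k)
  unmatched-of-selfNeg i z k g =
    not⁻ (proj₂ (∧⁻ g)) (selfNeg-neg⇒pos i k z (proj₁ (∧⁻ g)))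

  γ-respˡ : ∀ i i' j → T (α P i i') → T (γ P i j) → T (γ P i' j)
  γ-respˡ i i' j r g =
    ∧⁺ (transB (pos i') (pos i) (neg j) (symB (pos i) (pos i') r) (proj₁ (∧⁻ g)))
       (not⁺ (not⁻ (proj₂ (∧⁻ g)) ∘ transB (pos i) (pos i') (pos j) r))

  γ-respʳ : ∀ i j j' → T (α P j j') → T (γ P i j) → T (γ P i j')
  γ-respʳ i j j' r g =
    ∧⁺ (transB (pos i) (neg j) (neg j') (proj₁ (∧⁻ g)) (negate-rel (pos j) (pos j') r))
       (not⁺ (λ q → not⁻ (proj₂ (∧⁻ g))
                      (transB (pos i) (pos j') (pos j) q (symB (pos j) (pos j') r))))

  γ-sym : ∀ i j → T (γ P i j) → T (γ P j i)
  γ-sym i j g = ∧⁺ (cross-sym i j (proj₁ (∧⁻ g)))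
                   (not⁺ (not⁻ (proj₂ (∧⁻ g)) ∘ symB (pos j) (pos i)))

  β-resp : ∀ i j → T (α P i j) → T (β P i) → T (β P j)
  β-resp i j r b with anyFin⁻ _ b
  ... | k , p = anyFin⁺ _ k (transB (pos j) (pos i) (neg k) (symB (pos i) (pos j) r) p)

  γ-disjoint : ∀ i j k → T (γ P i j) → T (γ P i k) → T (α P j k)
  γ-disjoint i j k gj gk = negate-rel (neg j) (neg k)
    (transB (neg j) (pos i) (neg k) (symB (pos i) (neg j) (proj₁ (∧⁻ gj))) (proj₁ (∧⁻ gk)))

  -- Maximality of γ is exactly "at most one zero block".
  triple : IsTriple n (α P) (β P) (γ P)
  triple = record
    { partition  = record { reflB  = λ i → reflB (pos i)
                          ; symB   = λ i j → symB (pos i) (pos j)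
                          ; transB = λ i j k → transB (pos i) (pos j) (pos k) }
    ; X-blocks   = λ i j r → T-ext (β-resp i j r) (β-resp j i (symB (pos i) (pos j) r))
    ; M-blocksˡ  = λ i i' j r → T-ext (γ-respˡ i i' j r) (γ-respˡ i' i j (symB (pos i) (pos i') r))
    ; M-blocksʳ  = λ i j j' r → T-ext (γ-respʳ i j j' r) (γ-respʳ i j' j (symB (pos j) (pos j') r))
    ; M-inX      = λ i j g → anyFin⁺ _ j (proj₁ (∧⁻ g)) , anyFin⁺ _ i (cross-sym i j (proj₁ (∧⁻ g)))
    ; M-sym      = γ-sym
    ; M-distinct = λ i j g → not⁻ (proj₂ (∧⁻ g))
    ; M-disjoint = γ-disjoint
    ; M-maximal  = λ i j xi xj ui uj → atMostOneZero (pos i) (pos j)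
        (selfNeg-of-unmatched i xi ui) (selfNeg-of-unmatched j xj uj)
    }

  crossing-correct : ∀ i j → P (pos i) (neg j) ≡ crossing (α P) (β P) (γ P) i j
  crossing-correct i j = T-ext cross⇒formula formula⇒cross
    where
    cross⇒formula : T (P (pos i) (neg j)) → T (crossing (α P) (β P) (γ P) i j)
    cross⇒formula p with T? (P (pos i) (pos j))
    ... | no ¬q = ∨⁺ (inj₁ (∧⁺ p (not⁺ ¬q)))
    ... | yes q = ∨⁺ {γ P i j} (inj₂ (∧⁺ q (∧⁺ (anyFin⁺ _ j p) (not⁺ unmatched))))
      where
      unmatched : ¬ T (anyFin (γ P i))
      unmatched any with anyFin⁻ _ any
      ... | k , g = unmatched-of-selfNeg i (selfNeg-of-both i j p q) k g

    formula⇒cross : T (crossing (α P) (β P) (γ P) i j) → T (P (pos i) (neg j))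
    formula⇒cross c with ∨⁻ {γ P i j} c
    ... | inj₁ g = proj₁ (∧⁻ g)
    ... | inj₂ rz with ∧⁻ {α P i j} rz
    ...   | q , z with ∧⁻ {β P i} z
    ...     | b , none = selfNeg-pos⇒neg i j
                           (selfNeg-of-unmatched i b (anyFin-none (γ P i) none)) q

  reconstruction : P ≐₂ signedLift (α P) (crossing (α P) (β P) (γ P))
  reconstruction (pos i) (pos j) = refl
  reconstruction (neg i) (neg j) = negClosed (neg i) (neg j)
  reconstruction (pos i) (neg j) = crossing-correct i j
  reconstruction (neg i) (pos j) = trans (negClosed (neg i) (pos j)) (crossing-correct i j)

module FromTriple {n} {R : Fin n → Fin n → Bool} {X : Fin n → Bool}
                  {M : Fin n → Fin n → Bool} (t : IsTriple n R X M) where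
  open IsTriple t
  open IsEquivalenceB partition

  Z : Fin n → Bool
  Z = zeroBlock X M

  A : Fin n → Fin n → Bool
  A = crossing R X M

  Z-unmatched : ∀ i k → T (Z i) → ¬ T (M i k)
  Z-unmatched i k z = anyFin-none (M i) (proj₂ (∧⁻ z)) k

  Z-resp : ∀ i j → T (R i j) → T (Z i) → T (Z j)
  Z-resp i j r z = ∧⁺ (subst T (X-blocks i j r) (proj₁ (∧⁻ z))) (not⁺ matched⇒⊥)
    where
    matched⇒⊥ : ¬ T (anyFin (M j))
    matched⇒⊥ any with anyFin⁻ (M j) any
    ... | k , m = Z-unmatched i k z (subst T (sym (M-blocksˡ i j k r)) m)

  -- At most one block is unmatched, so Z holds on at most one block.
  Z-unique : ∀ i j → T (Z i) → T (Z j) → T (R i j)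
  Z-unique i j zi zj = M-maximal i j (proj₁ (∧⁻ zi)) (proj₁ (∧⁻ zj))
                         (λ k → Z-unmatched i k zi) (λ k → Z-unmatched j k zj)

  -- A block crossing to itself is not matched (M is irreflexive), so it is Z.
  Z-of-diag : ∀ i → T (A i i) → T (Z i)
  Z-of-diag i a with ∨⁻ {M i i} a
  ... | inj₁ m  = ⊥-elim (M-distinct i i m (reflB i))
  ... | inj₂ rz = proj₂ (∧⁻ {R i i} rz)

  A-sym : ∀ i j → T (A i j) → T (A j i)
  A-sym i j a with ∨⁻ {M i j} a
  ... | inj₁ m  = ∨⁺ (inj₁ (M-sym i j m))
  ... | inj₂ rz with ∧⁻ {R i j} rz
  ...   | r , z = ∨⁺ {M j i} (inj₂ (∧⁺ (symB i j r) (Z-resp i j r z)))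

  A-respˡ : ∀ i i' j → T (R i i') → T (A i j) → T (A i' j)
  A-respˡ i i' j r a with ∨⁻ {M i j} a
  ... | inj₁ m  = ∨⁺ (inj₁ (subst T (M-blocksˡ i i' j r) m))
  ... | inj₂ rz with ∧⁻ {R i j} rz
  ...   | r' , z = ∨⁺ {M i' j} (inj₂ (∧⁺ (transB i' i j (symB i i' r) r') (Z-resp i i' r z)))

  -- Two crossings compose to R: either both are matchings, and M is a
  -- matching, or both stay inside the zero block.
  A-A⇒R : ∀ i j k → T (A i j) → T (A j k) → T (R i k)
  A-A⇒R i j k a b with ∨⁻ {M i j} a | ∨⁻ {M j k} b
  ... | inj₁ m₁ | inj₁ m₂ = M-disjoint j i k (M-sym i j m₁) m₂
  ... | inj₁ m₁ | inj₂ rz = ⊥-elim (Z-unmatched j i (proj₂ (∧⁻ {R j k} rz)) (M-sym i j m₁))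
  ... | inj₂ rz | inj₁ m₂ with ∧⁻ {R i j} rz
  ...   | r , z = ⊥-elim (Z-unmatched i k z (subst T (sym (M-blocksˡ i j k r)) m₂))
  A-A⇒R i j k a b | inj₂ rz₁ | inj₂ rz₂ =
    transB i j k (proj₁ (∧⁻ {R i j} rz₁)) (proj₁ (∧⁻ {R j k} rz₂))

  isCrossing : IsCrossing R A
  isCrossing = record
    { A-sym   = A-sym
    ; A-respˡ = A-respˡ
    ; A-A⇒R   = A-A⇒R
    ; A-diag  = λ i j a b → Z-unique i j (Z-of-diag i a) (Z-of-diag j b)
    }

  P : Signed n → Signed n → Bool
  P = signedLift R A

  typeB : IsTypeB n P
  typeB = signedLift-typeB partition isCrossing

  -- i has a crossing partner iff its block is in X: a matched partner lies
  -- in X, and an unmatched block of X is crossed by i itself.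
  β-correct : β P ≐₁ X
  β-correct i = T-ext crossed⇒X X⇒crossed
    where
    crossed⇒X : T (β P i) → T (X i)
    crossed⇒X b with anyFin⁻ (A i) b
    ... | k , a with ∨⁻ {M i k} a
    ...   | inj₁ m  = proj₁ (M-inX i k m)
    ...   | inj₂ rz = proj₁ (∧⁻ (proj₂ (∧⁻ {R i k} rz)))

    X⇒crossed : T (X i) → T (β P i)
    X⇒crossed x with T? (anyFin (M i))
    ... | yes any with anyFin⁻ (M i) any
    ...   | k , m = anyFin⁺ (A i) k (∨⁺ (inj₁ m))
    X⇒crossed x | no none =
      anyFin⁺ (A i) i (∨⁺ {M i i} (inj₂ (∧⁺ (reflB i) (∧⁺ x (not⁺ none)))))

  -- A crossing between distinct blocks is a matching.
  γ-correct : γ P ≐₂ M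
  γ-correct i j = T-ext crossing⇒M (λ m → ∧⁺ (∨⁺ (inj₁ m)) (not⁺ (M-distinct i j m)))
    where
    crossing⇒M : T (γ P i j) → T (M i j)
    crossing⇒M g with ∧⁻ {A i j} g
    ... | a , ¬r with ∨⁻ {M i j} a
    ...   | inj₁ m  = m
    ...   | inj₂ rz = ⊥-elim (not⁻ ¬r (proj₁ (∧⁻ {R i j} rz)))

-- Injectivity: both partitions are the signed lift of the same data.
typeB-injective : ∀ {n} (P P' : Signed n → Signed n → Bool) → IsTypeB n P → IsTypeB n P'
                → α P ≐₂ α P' → β P ≐₁ β P' → γ P ≐₂ γ P' → P ≐₂ P'
typeB-injective P P' tb tb' eα eβ eγ x y = begin
  P x y
    ≡⟨ FromTypeB.reconstruction P tb x y ⟩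
  signedLift (α P) (crossing (α P) (β P) (γ P)) x y
    ≡⟨ signedLift-cong eα (crossing-cong eα eβ eγ) x y ⟩
  signedLift (α P') (crossing (α P') (β P') (γ P')) x y
    ≡⟨ sym (FromTypeB.reconstruction P' tb' x y) ⟩
  P' x y ∎
  where open ≡-Reasoning

proposition3p2 : (n : ℕ) → 1 ≤ n →
    ((P : Signed n → Signed n → Bool) → IsTypeB n P → IsTriple n (α P) (β P) (γ P))
    × ((P P' : Signed n → Signed n → Bool) → IsTypeB n P → IsTypeB n P'
        → α P ≐₂ α P' → β P ≐₁ β P' → γ P ≐₂ γ P' → P ≐₂ P')
    × ((R : Fin n → Fin n → Bool) (X : Fin n → Bool) (M : Fin n → Fin n → Bool)
        → IsTriple n R X M
        → Σ (Signed n → Signed n → Bool) (λ P → IsTypeB n P × α P ≐₂ R × β P ≐₁ X × γ P ≐₂ M))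
proposition3p2 n _ = FromTypeB.triple , typeB-injective , surjective
  where
  surjective : ∀ R X M → IsTriple n R X M
             → Σ (Signed n → Signed n → Bool) (λ P → IsTypeB n P × α P ≐₂ R × β P ≐₁ X × γ P ≐₂ M)
  surjective R X M t = P , typeB , (λ i j → refl) , β-correct , γ-correct
    where open FromTriple t
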